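{- Let $\mathbb{K}$ be a field, $n\geqslant 2$, and let $L$ be a set of lines of $\mathrm{AG}_n(\mathbb{K})$ whose set of directions $D\subseteq\mathrm{PG}_{n-1}(\mathbb{K})$ contains an $N^{n-1}$ grid. Let $S$ be a set of points of $\mathrm{AG}_n(\mathbb{K})$ such that every line of $L$ is incident with at least $N$ points of $S$. Then $$|S|\geqslant\binom{N+n-1}{n}.$$
   Context: The direction of a line $\{u+\lambda v:\lambda\in\mathbb{K}\}$ of $\mathrm{AG}_n(\mathbb{K})$ is the projective point $\langle v\rangle\in\mathrm{PG}_{n-1}(\mathbb{K})$. An $N^{n-1}$ grid in $\mathrm{PG}_{n-1}(\mathbb{K})$ is a point set which, with respect to a suitable basis, has the form $\{\langle (a_1,\ldots,a_{n-1},1)\rangle : a_i\in A_i\}$, where each $A_i$ is a subset of $\mathbb{K}$ of size $N$. -}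

module Defs where

open import Level using (Level; _⊔_; suc)
open import Data.Nat using (ℕ; zero) renaming (suc to sucℕ)
open import Data.Fin using (Fin)
open import Data.Product using (Σ; ∃; _×_; _,_)
open import Relation.Nullary using (¬_)
open import Relation.Binary.PropositionalEquality using (_≡_)
open import Algebra.Bundles using (CommutativeRing)

record Field (c ℓ : Level) : Set (suc (c ⊔ ℓ)) where
  field
    commutativeRing : CommutativeRing c ℓ
  open CommutativeRing commutativeRing public
  field
    0≉1     : ¬ (0# ≈ 1#)
    inverse : ∀ x → ¬ (x ≈ 0#) → ∃ λ y → x * y ≈ 1#

module AffineSpace {c ℓ} (K : Field c ℓ) where
  open Field K

  Vect : ℕ → Set c
  Vect n = Fin n → Carrier

  _≈ᵥ_ : ∀ {n} → Vect n → Vect n → Set ℓ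
  u ≈ᵥ v = ∀ i → u i ≈ v i

  0ᵥ : ∀ {n} → Vect n
  0ᵥ _ = 0#

  _+ᵥ_ : ∀ {n} → Vect n → Vect n → Vect n
  (u +ᵥ v) i = u i + v i

  _·_ : ∀ {n} → Carrier → Vect n → Vect n
  (λ' · v) i = λ' * v i

  sumᵥ : ∀ {n} k → (Fin k → Vect n) → Vect n
  sumᵥ zero     f = 0ᵥ
  sumᵥ (sucℕ k) f = f Fin.zero +ᵥ sumᵥ k (λ j → f (Fin.suc j))

  IsBasis : ∀ {n} → (Fin n → Vect n) → Set (c ⊔ ℓ)
  IsBasis {n} b =
    (∀ (a : Fin n → Carrier) → sumᵥ n (λ j → a j · b j) ≈ᵥ 0ᵥ → ∀ j → a j ≈ 0#)
    × (∀ (x : Vect n) → ∃ λ (a : Fin n → Carrier) → sumᵥ n (λ j → a j · b j) ≈ᵥ x)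

  OnLine : ∀ {n} → Vect n → Vect n → Vect n → Set (c ⊔ ℓ)
  OnLine p u v = ∃ λ t → p ≈ᵥ (u +ᵥ (t · v))

  -- the projective points ⟨v⟩ and ⟨w⟩ coincide (v, w nonzero)
  SameDirection : ∀ {n} → Vect n → Vect n → Set (c ⊔ ℓ)
  SameDirection v w = ∃ λ μ → v ≈ᵥ (μ · w)

  -- a subset of K of size N, given as an injective enumeration
  InjectiveFamily : ∀ {N} → (Fin N → Carrier) → Set ℓ
  InjectiveFamily {N} a = ∀ (i j : Fin N) → a i ≈ a j → i ≡ j

module Submission where

-- Work in coordinates with respect to the basis b, so that the grid directions
-- are the vectors (a₁,…,aₘ,1) with aᵢ ∈ Aᵢ.  Evaluating polynomials of degree
-- < N in n = m+1 variables at the points of S gives |S| linear forms on the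
-- space of such polynomials, whose dimension is C(N+m, m+1).  These forms have
-- trivial common kernel: if F has degree D < N and vanishes on S, restrict F to
-- a line l of L.  This gives a univariate polynomial of degree ≤ D with N > D
-- roots, so its X^D-coefficient, which is the leading form of F evaluated at the
-- direction of l, vanishes.  By homogeneity the leading form vanishes on the
-- whole grid, hence is zero (a grid Nullstellensatz for forms of degree < N),
-- and induction on D finishes.  Elimination of variables then shows that |S|
-- linear forms with trivial common kernel need dimension ≤ |S|.

open import Defs
open import Level using (_⊔_)
open import Function using (_∘_)
open import Data.Nat as ℕ using (ℕ; zero; suc; _≤_; _<_; z≤n; s≤s)
import Data.Nat.Properties as ℕP
open import Data.Nat.Combinatorics using (_C_; nCn≡1; nCk+nC[k+1]≡[n+1]C[k+1]; k>n⇒nCk≡0)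
open import Data.Fin using (Fin; zero; suc; _↑ˡ_; _↑ʳ_; inject≤; inject₁; fromℕ; splitAt; punchIn)
import Data.Fin.Properties as FinP
open import Data.Vec.Functional using (head; tail) renaming (_∷_ to _∷ᵥ_)
open import Data.Sum using (inj₁; inj₂)
open import Data.Product using (∃; _×_; _,_; proj₁; proj₂)
open import Data.List using (List; length; lookup)
open import Data.List.Membership.Propositional.Properties using (∈-lookup)
import Data.List.Relation.Unary.All as All
open import Data.List.Relation.Unary.AllPairs using (AllPairs; _∷_)
open import Data.Empty using (⊥-elim)
open import Relation.Nullary using (¬_; yes; no)
open import Relation.Nullary.Decidable using (decidable-stable)
open import Relation.Binary.PropositionalEquality as ≡ using (_≡_)
import Algebra.Properties.Ring as RingProperties
open import Algebra.Bundles using (Semiring)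

-- Dimension counts.  homDim k n is the number of monomials of degree k in n
-- variables and polyDim D n the number of monomials of degree < D; both are
-- given by the recursions used below to enumerate monomials.

homDim : ℕ → ℕ → ℕ
homDim zero    n       = 1
homDim (suc k) zero    = 0
homDim (suc k) (suc n) = homDim (suc k) n ℕ.+ homDim k (suc n)

polyDim : ℕ → ℕ → ℕ
polyDim zero    n = 0
polyDim (suc D) n = polyDim D n ℕ.+ homDim D n

homDim-binomial : ∀ k m → homDim k (suc m) ≡ (k ℕ.+ m) C m
homDim-binomial zero    m       = ≡.sym (nCn≡1 m)
homDim-binomial (suc k) zero    = homDim-binomial k zero
homDim-binomial (suc k) (suc m) = begin
  homDim (suc k) (suc m) ℕ.+ homDim k (suc (suc m))
    ≡⟨ ≡.cong₂ ℕ._+_ (homDim-binomial (suc k) m) (homDim-binomial k (suc m)) ⟩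
  (suc k ℕ.+ m) C m ℕ.+ (k ℕ.+ suc m) C suc m
    ≡⟨ ≡.cong (λ z → (suc k ℕ.+ m) C m ℕ.+ z C suc m) (ℕP.+-suc k m) ⟩
  suc (k ℕ.+ m) C m ℕ.+ suc (k ℕ.+ m) C suc m
    ≡⟨ nCk+nC[k+1]≡[n+1]C[k+1] (suc (k ℕ.+ m)) m ⟩
  suc (suc (k ℕ.+ m)) C suc m
    ≡⟨ ≡.cong (λ z → suc z C suc m) (≡.sym (ℕP.+-suc k m)) ⟩
  (suc k ℕ.+ suc m) C suc m ∎
  where open ≡.≡-Reasoning

polyDim-binomial : ∀ D m → polyDim D (suc m) ≡ (D ℕ.+ m) C suc m
polyDim-binomial zero    m = ≡.sym (k>n⇒nCk≡0 (ℕP.n<1+n m))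
polyDim-binomial (suc D) m = begin
  polyDim D (suc m) ℕ.+ homDim D (suc m)
    ≡⟨ ≡.cong₂ ℕ._+_ (polyDim-binomial D m) (homDim-binomial D m) ⟩
  (D ℕ.+ m) C suc m ℕ.+ (D ℕ.+ m) C m
    ≡⟨ ℕP.+-comm ((D ℕ.+ m) C suc m) _ ⟩
  (D ℕ.+ m) C m ℕ.+ (D ℕ.+ m) C suc m
    ≡⟨ nCk+nC[k+1]≡[n+1]C[k+1] (D ℕ.+ m) m ⟩
  (suc D ℕ.+ m) C suc m ∎
  where open ≡.≡-Reasoning

module PolynomialMethod {c ℓ} (K : Field c ℓ) where
  open Field K hiding (zero)
  open AffineSpace K
  module R = RingProperties ring
  open import Algebra.Definitions.RawSemiring (Semiring.rawSemiring semiring) using (_^_)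
  open import Algebra.Solver.Ring.NaturalCoefficients.Default commutativeSemiring
  open import Relation.Binary.Reasoning.Setoid setoid

  *-cancel-nonzero : ∀ {a y} → ¬ (a ≈ 0#) → a * y ≈ 0# → y ≈ 0#
  *-cancel-nonzero {a} {y} a≉0 ay≈0 with inverse a a≉0
  ... | a⁻¹ , aa⁻¹≈1 = begin
     y              ≈⟨ sym (*-identityˡ y) ⟩
     1# * y         ≈⟨ *-cong (sym aa⁻¹≈1) refl ⟩
     (a * a⁻¹) * y  ≈⟨ solve 3 (λ a b y → (a :* b) :* y := b :* (a :* y)) refl a a⁻¹ y ⟩
     a⁻¹ * (a * y)  ≈⟨ *-cong refl ay≈0 ⟩
     a⁻¹ * 0#       ≈⟨ zeroʳ a⁻¹ ⟩
     0#             ∎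

  ^-cancel-nonzero : ∀ μ k {y} → ¬ (μ ≈ 0#) → μ ^ k * y ≈ 0# → y ≈ 0#
  ^-cancel-nonzero μ zero    μ≉0 e = trans (sym (*-identityˡ _)) e
  ^-cancel-nonzero μ (suc k) μ≉0 e =
    ^-cancel-nonzero μ k μ≉0 (*-cancel-nonzero μ≉0 (trans (sym (*-assoc _ _ _)) e))

  zero≈α0+β0 : ∀ α β → 0# ≈ α * 0# + β * 0#
  zero≈α0+β0 α β = sym (trans (+-cong (zeroʳ α) (zeroʳ β)) (+-identityˡ 0#))

  tail-injective : ∀ {k} {r : Fin (suc k) → Carrier} → InjectiveFamily r → InjectiveFamily (tail r)
  tail-injective inj i j e = FinP.suc-injective (inj (suc i) (suc j) e)

  zero-split : ∀ a b (h : Vect (a ℕ.+ b)) → (∀ i → h (i ↑ˡ b) ≈ 0#) → (∀ j → h (a ↑ʳ j) ≈ 0#) → h ≈ᵥ 0ᵥ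
  zero-split a b h left right i with splitAt a i in eq
  ... | inj₁ j = ≡.subst (λ z → h z ≈ 0#) (FinP.splitAt⁻¹-↑ˡ eq) (left j)
  ... | inj₂ j = ≡.subst (λ z → h z ≈ 0#) (FinP.splitAt⁻¹-↑ʳ eq) (right j)

  -- Univariate polynomials of formal degree ≤ D, as coefficient lists from the
  -- constant term upwards:  a +X· p  stands for  a + X·p.
  infixr 5 _+X·_
  data UPoly : ℕ → Set c where
    const : Carrier → UPoly zero
    _+X·_ : ∀ {D} → Carrier → UPoly D → UPoly (suc D)

  eval : ∀ {D} → UPoly D → Carrier → Carrier
  eval (const a) t = a
  eval (a +X· p) t = a + t * eval p t

  eval-cong : ∀ {D} (p : UPoly D) {s t} → s ≈ t → eval p s ≈ eval p t
  eval-cong (const a) s≈t = refl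
  eval-cong (a +X· p) s≈t = +-cong refl (*-cong s≈t (eval-cong p s≈t))

  lead : ∀ {D} → UPoly D → Carrier
  lead (const a) = a
  lead (a +X· p) = lead p

  IsZero : ∀ {D} → UPoly D → Set ℓ
  IsZero (const a) = a ≈ 0#
  IsZero (a +X· p) = a ≈ 0# × IsZero p

  -- Horner's scheme: the quotient q of p by X − r, so that p = p(r) + (X − r)·q.
  divLinear : ∀ {D} → UPoly (suc D) → Carrier → UPoly D
  divLinear (a +X· const b)         r = const b
  divLinear (a +X· p@(_ +X· _)) r = eval p r +X· divLinear p r

  lead-divLinear : ∀ {D} (p : UPoly (suc D)) r → lead (divLinear p r) ≡ lead p
  lead-divLinear (a +X· const b)         r = ≡.refl
  lead-divLinear (a +X· p@(_ +X· _)) r = lead-divLinear p r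

  eval-divLinear-shift : ∀ {D} (p : UPoly (suc D)) r d →
    eval p (r + d) ≈ eval p r + d * eval (divLinear p r) (r + d)
  eval-divLinear-shift (a +X· const b) r d =
    solve 4 (λ a b r d → a :+ (r :+ d) :* b := (a :+ r :* b) :+ d :* b) refl a b r d
  eval-divLinear-shift (a +X· p@(_ +X· _)) r d = begin
    a + (r + d) * eval p (r + d)
      ≈⟨ +-cong refl (*-cong refl (eval-divLinear-shift p r d)) ⟩
    a + (r + d) * (eval p r + d * Q)
      ≈⟨ solve 5 (λ a r d A Q → a :+ (r :+ d) :* (A :+ d :* Q)
                               := (a :+ r :* A) :+ d :* (A :+ (r :+ d) :* Q)) refl a r d (eval p r) Q ⟩
    (a + r * eval p r) + d * (eval p r + (r + d) * Q) ∎
    where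
    Q : Carrier
    Q = eval (divLinear p r) (r + d)

  eval-divLinear : ∀ {D} (p : UPoly (suc D)) r t → eval p t ≈ eval p r + (t - r) * eval (divLinear p r) t
  eval-divLinear {D} p r t = begin
    eval p t                                   ≈⟨ eval-cong p t≈r+[t-r] ⟩
    eval p (r + (t - r))                       ≈⟨ eval-divLinear-shift p r (t - r) ⟩
    eval p r + (t - r) * eval q (r + (t - r))  ≈⟨ +-cong refl (*-cong refl (eval-cong q (sym t≈r+[t-r]))) ⟩
    eval p r + (t - r) * eval q t              ∎
    where
    q : UPoly D
    q = divLinear p r
    t≈r+[t-r] : t ≈ r + (t - r)
    t≈r+[t-r] = begin
      t                ≈⟨ sym (+-identityʳ t) ⟩
      t + 0#           ≈⟨ +-cong refl (sym (-‿inverseˡ r)) ⟩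
      t + (- r + r)    ≈⟨ sym (+-assoc t (- r) r) ⟩
      (t - r) + r      ≈⟨ +-comm (t - r) r ⟩
      r + (t - r)      ∎

  divLinear-root : ∀ {D} (p : UPoly (suc D)) {r t} → eval p r ≈ 0# → eval p t ≈ 0# → ¬ (t ≈ r) →
    eval (divLinear p r) t ≈ 0#
  divLinear-root p {r} {t} pr≈0 pt≈0 t≉r = *-cancel-nonzero t-r≉0 (begin
    (t - r) * eval (divLinear p r) t        ≈⟨ sym (+-identityˡ _) ⟩
    0# + (t - r) * eval (divLinear p r) t   ≈⟨ +-cong (sym pr≈0) refl ⟩
    eval p r + (t - r) * eval (divLinear p r) t ≈⟨ sym (eval-divLinear p r t) ⟩
    eval p t                                ≈⟨ pt≈0 ⟩
    0#                                      ∎)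
    where
    t-r≉0 : ¬ (t - r ≈ 0#)
    t-r≉0 = t≉r ∘ R.x∙y⁻¹≈ε⇒x≈y t r

  -- A polynomial of degree ≤ D with D+1 distinct roots has vanishing
  -- X^D-coefficient: divide by X − r₀ and use the remaining D roots.
  lead-vanishes : ∀ D (p : UPoly D) (r : Fin (suc D) → Carrier) → InjectiveFamily r →
    (∀ i → eval p (r i) ≈ 0#) → lead p ≈ 0#
  lead-vanishes zero    (const a) r inj roots = roots zero
  lead-vanishes (suc D) p         r inj roots =
    trans (reflexive (≡.sym (lead-divLinear p (r zero))))
          (lead-vanishes D (divLinear p (r zero)) (tail r) (tail-injective inj) quotient-roots)
    where
    quotient-roots : ∀ i → eval (divLinear p (r zero)) (r (suc i)) ≈ 0#
    quotient-roots i = divLinear-root p (roots zero) (roots (suc i))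
                         (λ e → FinP.0≢1+n (≡.sym (inj (suc i) zero e)))

  dropLead : ∀ {D} → UPoly (suc D) → UPoly D
  dropLead (a +X· const b)         = const a
  dropLead (a +X· p@(_ +X· _)) = a +X· dropLead p

  eval-dropLead : ∀ {D} (p : UPoly (suc D)) t → lead p ≈ 0# → eval (dropLead p) t ≈ eval p t
  eval-dropLead (a +X· const b) t b≈0 = begin
    a            ≈⟨ sym (+-identityʳ a) ⟩
    a + 0#       ≈⟨ +-cong refl (sym (zeroʳ t)) ⟩
    a + t * 0#   ≈⟨ +-cong refl (*-cong refl (sym b≈0)) ⟩
    a + t * b    ∎
  eval-dropLead (a +X· p@(_ +X· _)) t lead≈0 = +-cong refl (*-cong refl (eval-dropLead p t lead≈0))

  IsZero-dropLead : ∀ {D} (p : UPoly (suc D)) → lead p ≈ 0# → IsZero (dropLead p) → IsZero p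
  IsZero-dropLead (a +X· const b)         b≈0    a≈0          = a≈0 , b≈0
  IsZero-dropLead (a +X· p@(_ +X· _)) lead≈0 (a≈0 , p≈0) = a≈0 , IsZero-dropLead p lead≈0 p≈0

  roots⇒IsZero : ∀ D (p : UPoly D) (r : Fin (suc D) → Carrier) → InjectiveFamily r →
    (∀ i → eval p (r i) ≈ 0#) → IsZero p
  roots⇒IsZero zero    (const a) r inj roots = roots zero
  roots⇒IsZero (suc D) p         r inj roots =
    IsZero-dropLead p lead≈0
      (roots⇒IsZero D (dropLead p) (tail r) (tail-injective inj)
        (λ i → trans (eval-dropLead p (r (suc i)) lead≈0) (roots (suc i))))
    where
    lead≈0 : lead p ≈ 0#
    lead≈0 = lead-vanishes (suc D) p r inj roots

  zeroU : ∀ D → UPoly D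
  zeroU zero    = const 0#
  zeroU (suc D) = 0# +X· zeroU D

  eval-zeroU : ∀ D t → eval (zeroU D) t ≈ 0#
  eval-zeroU zero    t = refl
  eval-zeroU (suc D) t = begin
    0# + t * eval (zeroU D) t  ≈⟨ +-cong refl (*-cong refl (eval-zeroU D t)) ⟩
    0# + t * 0#                ≈⟨ +-identityˡ _ ⟩
    t * 0#                     ≈⟨ zeroʳ t ⟩
    0#                         ∎

  lead-zeroU : ∀ D → lead (zeroU D) ≡ 0#
  lead-zeroU zero    = ≡.refl
  lead-zeroU (suc D) = lead-zeroU D

  infixl 6 _⊕_
  _⊕_ : ∀ {D} → UPoly D → UPoly D → UPoly D
  const a   ⊕ const b   = const (a + b)
  (a +X· p) ⊕ (b +X· q) = (a + b) +X· (p ⊕ q)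

  eval-⊕ : ∀ {D} (p q : UPoly D) t → eval (p ⊕ q) t ≈ eval p t + eval q t
  eval-⊕ (const a)   (const b)   t = refl
  eval-⊕ (a +X· p) (b +X· q) t = trans (+-cong refl (*-cong refl (eval-⊕ p q t)))
    (solve 5 (λ a b t P Q → (a :+ b) :+ t :* (P :+ Q) := (a :+ t :* P) :+ (b :+ t :* Q))
             refl a b t (eval p t) (eval q t))

  lead-⊕ : ∀ {D} (p q : UPoly D) → lead (p ⊕ q) ≡ lead p + lead q
  lead-⊕ (const a)   (const b)   = ≡.refl
  lead-⊕ (a +X· p) (b +X· q) = lead-⊕ p q

  raise : ∀ {D} → UPoly D → UPoly (suc D)
  raise (const a) = a +X· const 0#
  raise (a +X· p) = a +X· raise p

  eval-raise : ∀ {D} (p : UPoly D) t → eval (raise p) t ≈ eval p t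
  eval-raise (const a) t = trans (+-cong refl (zeroʳ t)) (+-identityʳ a)
  eval-raise (a +X· p) t = +-cong refl (*-cong refl (eval-raise p t))

  lead-raise : ∀ {D} (p : UPoly D) → lead (raise p) ≡ 0#
  lead-raise (const a) = ≡.refl
  lead-raise (a +X· p) = lead-raise p

  addConst : ∀ {D} → Carrier → UPoly D → UPoly D
  addConst x (const a) = const (x + a)
  addConst x (a +X· p) = (x + a) +X· p

  eval-addConst : ∀ {D} x (p : UPoly D) t → eval (addConst x p) t ≈ x + eval p t
  eval-addConst x (const a) t = refl
  eval-addConst x (a +X· p) t = +-assoc x a _

  lead-addConst : ∀ {D} x (p : UPoly (suc D)) → lead (addConst x p) ≡ lead p
  lead-addConst x (a +X· p) = ≡.refl

  mulLinear : ∀ {D} → Carrier → Carrier → UPoly D → UPoly (suc D)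
  mulLinear a b (const x) = (a * x) +X· const (b * x)
  mulLinear a b (x +X· p) = (a * x) +X· addConst (b * x) (mulLinear a b p)

  eval-mulLinear : ∀ {D} a b (p : UPoly D) t → eval (mulLinear a b p) t ≈ (a + t * b) * eval p t
  eval-mulLinear a b (const x) t =
    solve 4 (λ a b x t → a :* x :+ t :* (b :* x) := (a :+ t :* b) :* x) refl a b x t
  eval-mulLinear a b (x +X· p) t = begin
    a * x + t * eval (addConst (b * x) (mulLinear a b p)) t
      ≈⟨ +-cong refl (*-cong refl (eval-addConst (b * x) (mulLinear a b p) t)) ⟩
    a * x + t * (b * x + eval (mulLinear a b p) t)
      ≈⟨ +-cong refl (*-cong refl (+-cong refl (eval-mulLinear a b p t))) ⟩
    a * x + t * (b * x + (a + t * b) * eval p t)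
      ≈⟨ solve 5 (λ a b x t P → a :* x :+ t :* (b :* x :+ (a :+ t :* b) :* P)
                               := (a :+ t :* b) :* (x :+ t :* P)) refl a b x t (eval p t) ⟩
    (a + t * b) * (x + t * eval p t) ∎

  lead-mulLinear : ∀ {D} a b (p : UPoly D) → lead (mulLinear a b p) ≈ b * lead p
  lead-mulLinear a b (const x) = refl
  lead-mulLinear a b (x +X· p) =
    trans (reflexive (lead-addConst (b * x) (mulLinear a b p))) (lead-mulLinear a b p)

  -- Forms (homogeneous polynomials) of degree k in n variables, as coefficient
  -- vectors.  Monomials are enumerated recursively: a form of degree k+1 in
  -- x₀,…,x_{n} is  R(x₁,…,x_{n}) + x₀·G(x₀,…,x_{n})  with R of degree k+1 in
  -- one variable fewer and G of degree k.
  Form : ℕ → ℕ → Set c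
  Form k n = Vect (homDim k n)

  restForm : ∀ k n → Form (suc k) (suc n) → Form (suc k) n
  restForm k n h i = h (i ↑ˡ homDim k (suc n))

  x₀Form : ∀ k n → Form (suc k) (suc n) → Form k (suc n)
  x₀Form k n h i = h (homDim (suc k) n ↑ʳ i)

  evalForm : ∀ k n → Form k n → Vect n → Carrier
  evalForm zero    n       h x = h zero
  evalForm (suc k) zero    h x = 0#
  evalForm (suc k) (suc n) h x =
    evalForm (suc k) n (restForm k n h) (tail x) + head x * evalForm k (suc n) (x₀Form k n h) x

  evalForm-cong : ∀ k n h {x y : Vect n} → x ≈ᵥ y → evalForm k n h x ≈ evalForm k n h y
  evalForm-cong zero    n       h x≈y = refl
  evalForm-cong (suc k) zero    h x≈y = refl
  evalForm-cong (suc k) (suc n) h x≈y =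
    +-cong (evalForm-cong (suc k) n _ (x≈y ∘ suc)) (*-cong (x≈y zero) (evalForm-cong k (suc n) _ x≈y))

  evalForm-zero : ∀ k n (h : Form k n) → h ≈ᵥ 0ᵥ → ∀ x → evalForm k n h x ≈ 0#
  evalForm-zero zero    n       h h≈0 x = h≈0 zero
  evalForm-zero (suc k) zero    h h≈0 x = refl
  evalForm-zero (suc k) (suc n) h h≈0 x = begin
    evalForm (suc k) n (restForm k n h) (tail x) + head x * evalForm k (suc n) (x₀Form k n h) x
      ≈⟨ +-cong (evalForm-zero (suc k) n _ (λ i → h≈0 _) _)
                (*-cong refl (evalForm-zero k (suc n) _ (λ i → h≈0 _) x)) ⟩
    0# + head x * 0#  ≈⟨ +-identityˡ _ ⟩
    head x * 0#       ≈⟨ zeroʳ _ ⟩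
    0#                ∎

  evalForm-homogeneous : ∀ k n (h : Form k n) μ x → evalForm k n h (μ · x) ≈ μ ^ k * evalForm k n h x
  evalForm-homogeneous zero    n       h μ x = sym (*-identityˡ _)
  evalForm-homogeneous (suc k) zero    h μ x = sym (zeroʳ _)
  evalForm-homogeneous (suc k) (suc n) h μ x =
    trans (+-cong (evalForm-homogeneous (suc k) n _ μ _) (*-cong refl (evalForm-homogeneous k (suc n) _ μ x)))
          (solve 5 (λ μ Pk R x₀ G → (μ :* Pk) :* R :+ (μ :* x₀) :* (Pk :* G) := (μ :* Pk) :* (R :+ x₀ :* G))
                   refl μ (μ ^ k) _ (head x) _)

  restrictForm : ∀ k n → Form k n → Vect n → Vect n → UPoly k
  restrictForm zero    n       h u v = const (h zero)
  restrictForm (suc k) zero    h u v = zeroU (suc k)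
  restrictForm (suc k) (suc n) h u v =
    restrictForm (suc k) n (restForm k n h) (tail u) (tail v)
      ⊕ mulLinear (head u) (head v) (restrictForm k (suc n) (x₀Form k n h) u v)

  eval-restrictForm : ∀ k n h u v t → eval (restrictForm k n h u v) t ≈ evalForm k n h (u +ᵥ (t · v))
  eval-restrictForm zero    n       h u v t = refl
  eval-restrictForm (suc k) zero    h u v t = eval-zeroU (suc k) t
  eval-restrictForm (suc k) (suc n) h u v t =
    trans (eval-⊕ rest x₀part t)
      (+-cong (eval-restrictForm (suc k) n (restForm k n h) (tail u) (tail v) t)
              (trans (eval-mulLinear (head u) (head v) (restrictForm k (suc n) (x₀Form k n h) u v) t)
                     (*-cong refl (eval-restrictForm k (suc n) (x₀Form k n h) u v t))))
    where
    rest : UPoly (suc k)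
    rest   = restrictForm (suc k) n (restForm k n h) (tail u) (tail v)
    x₀part : UPoly (suc k)
    x₀part = mulLinear (head u) (head v) (restrictForm k (suc n) (x₀Form k n h) u v)

  lead-restrictForm : ∀ k n h u v → lead (restrictForm k n h u v) ≈ evalForm k n h v
  lead-restrictForm zero    n       h u v = refl
  lead-restrictForm (suc k) zero    h u v = reflexive (lead-zeroU (suc k))
  lead-restrictForm (suc k) (suc n) h u v =
    trans (reflexive (lead-⊕ rest x₀part))
      (+-cong (lead-restrictForm (suc k) n (restForm k n h) (tail u) (tail v))
              (trans (lead-mulLinear (head u) (head v) (restrictForm k (suc n) (x₀Form k n h) u v))
                     (*-cong refl (lead-restrictForm k (suc n) (x₀Form k n h) u v))))
    where
    rest : UPoly (suc k)
    rest   = restrictForm (suc k) n (restForm k n h) (tail u) (tail v)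
    x₀part : UPoly (suc k)
    x₀part = mulLinear (head u) (head v) (restrictForm k (suc n) (x₀Form k n h) u v)

  evalForm-congᶜ : ∀ k n {h h′ : Form k n} → h ≈ᵥ h′ → ∀ x → evalForm k n h x ≈ evalForm k n h′ x
  evalForm-congᶜ zero    n       h≈h′ x = h≈h′ zero
  evalForm-congᶜ (suc k) zero    h≈h′ x = refl
  evalForm-congᶜ (suc k) (suc n) h≈h′ x =
    +-cong (evalForm-congᶜ (suc k) n (λ i → h≈h′ _) _) (*-cong refl (evalForm-congᶜ k (suc n) (λ i → h≈h′ _) x))

  evalForm-linear : ∀ k n (h h′ : Form k n) α β x →
    evalForm k n ((α · h) +ᵥ (β · h′)) x ≈ α * evalForm k n h x + β * evalForm k n h′ x
  evalForm-linear zero    n       h h′ α β x = refl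
  evalForm-linear (suc k) zero    h h′ α β x = zero≈α0+β0 α β
  evalForm-linear (suc k) (suc n) h h′ α β x =
    trans (+-cong (evalForm-linear (suc k) n _ _ α β _) (*-cong refl (evalForm-linear k (suc n) _ _ α β x)))
          (solve 7 (λ α β R R′ x₀ G G′ → (α :* R :+ β :* R′) :+ x₀ :* (α :* G :+ β :* G′)
                                        := α :* (R :+ x₀ :* G) :+ β :* (R′ :+ x₀ :* G′))
                   refl α β _ _ (head x) _ _)

  -- Polynomials of degree < D in n variables: the sum of one form of each
  -- degree below D.  A polynomial of degree ≤ D splits into its part of degree
  -- < D and its top form of degree D.
  Poly : ℕ → ℕ → Set c
  Poly D n = Vect (polyDim D n)

  lowerPart : ∀ D n → Poly (suc D) n → Poly D n
  lowerPart D n F i = F (i ↑ˡ homDim D n)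

  topForm : ∀ D n → Poly (suc D) n → Form D n
  topForm D n F i = F (polyDim D n ↑ʳ i)

  evalPoly : ∀ D n → Poly D n → Vect n → Carrier
  evalPoly zero    n F x = 0#
  evalPoly (suc D) n F x = evalPoly D n (lowerPart D n F) x + evalForm D n (topForm D n F) x

  evalPoly-cong : ∀ D n F {x y : Vect n} → x ≈ᵥ y → evalPoly D n F x ≈ evalPoly D n F y
  evalPoly-cong zero    n F x≈y = refl
  evalPoly-cong (suc D) n F x≈y = +-cong (evalPoly-cong D n _ x≈y) (evalForm-cong D n _ x≈y)

  evalPoly-congᶜ : ∀ D n {F F′ : Poly D n} → F ≈ᵥ F′ → ∀ x → evalPoly D n F x ≈ evalPoly D n F′ x
  evalPoly-congᶜ zero    n F≈F′ x = refl
  evalPoly-congᶜ (suc D) n F≈F′ x =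
    +-cong (evalPoly-congᶜ D n (λ i → F≈F′ _) x) (evalForm-congᶜ D n (λ i → F≈F′ _) x)

  evalPoly-linear : ∀ D n (F F′ : Poly D n) α β x →
    evalPoly D n ((α · F) +ᵥ (β · F′)) x ≈ α * evalPoly D n F x + β * evalPoly D n F′ x
  evalPoly-linear zero    n F F′ α β x = zero≈α0+β0 α β
  evalPoly-linear (suc D) n F F′ α β x =
    trans (+-cong (evalPoly-linear D n _ _ α β x) (evalForm-linear D n _ _ α β x))
          (solve 6 (λ α β L L′ T T′ → (α :* L :+ β :* L′) :+ (α :* T :+ β :* T′)
                                     := α :* (L :+ T) :+ β :* (L′ :+ T′))
                   refl α β _ _ _ _)

  restrictPoly : ∀ D n → Poly (suc D) n → Vect n → Vect n → UPoly D
  restrictPoly zero    n F u v = restrictForm zero n (topForm zero n F) u v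
  restrictPoly (suc D) n F u v =
    raise (restrictPoly D n (lowerPart (suc D) n F) u v) ⊕ restrictForm (suc D) n (topForm (suc D) n F) u v

  eval-restrictPoly : ∀ D n F u v t → eval (restrictPoly D n F u v) t ≈ evalPoly (suc D) n F (u +ᵥ (t · v))
  eval-restrictPoly zero    n F u v t = sym (+-identityˡ _)
  eval-restrictPoly (suc D) n F u v t =
    trans (eval-⊕ (raise lower) top t)
      (+-cong (trans (eval-raise lower t) (eval-restrictPoly D n (lowerPart (suc D) n F) u v t))
              (eval-restrictForm (suc D) n (topForm (suc D) n F) u v t))
    where
    lower : UPoly D
    lower = restrictPoly D n (lowerPart (suc D) n F) u v
    top : UPoly (suc D)
    top   = restrictForm (suc D) n (topForm (suc D) n F) u v

  lead-restrictPoly : ∀ D n F u v → lead (restrictPoly D n F u v) ≈ evalForm D n (topForm D n F) v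
  lead-restrictPoly zero    n F u v = refl
  lead-restrictPoly (suc D) n F u v = begin
    lead (raise lower ⊕ top)        ≈⟨ reflexive (lead-⊕ (raise lower) top) ⟩
    lead (raise lower) + lead top   ≈⟨ +-cong (reflexive (lead-raise lower)) (lead-restrictForm (suc D) n _ u v) ⟩
    0# + evalForm (suc D) n (topForm (suc D) n F) v ≈⟨ +-identityˡ _ ⟩
    evalForm (suc D) n (topForm (suc D) n F) v ∎
    where
    lower : UPoly D
    lower = restrictPoly D n (lowerPart (suc D) n F) u v
    top : UPoly (suc D)
    top   = restrictForm (suc D) n (topForm (suc D) n F) u v

  topForm-vanishes : ∀ D n (F : Poly (suc D) n) u v (t : Fin (suc D) → Carrier) → InjectiveFamily t →
    (∀ i → evalPoly (suc D) n F (u +ᵥ (t i · v)) ≈ 0#) → evalForm D n (topForm D n F) v ≈ 0#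
  topForm-vanishes D n F u v t t-inj zeros =
    trans (sym (lead-restrictPoly D n F u v))
          (lead-vanishes D (restrictPoly D n F u v) t t-inj
            (λ i → trans (eval-restrictPoly D n F u v (t i)) (zeros i)))

  -- The grid.  withOne m a = (a₁,…,aₘ,1), and gridPoint A f picks the point
  -- (A₁(f₁),…,Aₘ(fₘ),1) of the grid A₁ × ⋯ × Aₘ × {1}.
  withOne : ∀ m → Vect m → Vect (suc m)
  withOne zero    a _       = 1#
  withOne (suc m) a zero    = head a
  withOne (suc m) a (suc i) = withOne m (tail a) i

  gridPoint : ∀ {m N} → (Fin m → Fin N → Carrier) → (Fin m → Fin N) → Vect (suc m)
  gridPoint {m} A f = withOne m (λ i → A i (f i))

  unary-form-zero : ∀ k (h : Form k 1) → evalForm k 1 h (λ _ → 1#) ≈ 0# → h ≈ᵥ 0ᵥ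
  unary-form-zero zero    h h1≈0 zero = h1≈0
  unary-form-zero (suc k) h h1≈0 = zero-split 0 (homDim k 1) h (λ ()) (unary-form-zero k h h1≈0′)
    where
    h1≈0′ : evalForm k 1 h (λ _ → 1#) ≈ 0#
    h1≈0′ = begin
      evalForm k 1 h (λ _ → 1#)             ≈⟨ sym (*-identityˡ _) ⟩
      1# * evalForm k 1 h (λ _ → 1#)        ≈⟨ sym (+-identityˡ _) ⟩
      0# + 1# * evalForm k 1 h (λ _ → 1#)   ≈⟨ h1≈0 ⟩
      0#                                     ∎

  -- A form h of degree k in x₀,…,x_{n+1}, expanded as a polynomial in x₀ whose
  -- coefficients are the values at a point a of forms in x₁,…,x_{n+1}:
  -- the X^j-coefficient is the rest form of degree k−j.
  x₀Expansion : ∀ k n → Form k (suc (suc n)) → Vect (suc n) → UPoly k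
  x₀Expansion zero    n h a = const (h zero)
  x₀Expansion (suc k) n h a =
    evalForm (suc k) (suc n) (restForm k (suc n) h) a +X· x₀Expansion k n (x₀Form k (suc n) h) a

  eval-x₀Expansion : ∀ k n h a t → eval (x₀Expansion k n h a) t ≈ evalForm k (suc (suc n)) h (t ∷ᵥ a)
  eval-x₀Expansion zero    n h a t = refl
  eval-x₀Expansion (suc k) n h a t = +-cong refl (*-cong refl (eval-x₀Expansion k n _ a t))

  x₀Expansion-zero : ∀ {a} {I : Set a} k n (h : Form k (suc (suc n))) (P : I → Vect (suc n)) →
    (∀ k′ → k′ ≤ k → (h′ : Form k′ (suc n)) → (∀ g → evalForm k′ (suc n) h′ (P g) ≈ 0#) → h′ ≈ᵥ 0ᵥ) →
    (∀ g → IsZero (x₀Expansion k n h (P g))) → h ≈ᵥ 0ᵥ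
  x₀Expansion-zero zero    n h P rest-zero coeffs-zero = rest-zero zero z≤n h coeffs-zero
  x₀Expansion-zero (suc k) n h P rest-zero coeffs-zero =
    zero-split (homDim (suc k) (suc n)) (homDim k (suc (suc n))) h
      (rest-zero (suc k) ℕP.≤-refl (restForm k (suc n) h) (proj₁ ∘ coeffs-zero))
      (x₀Expansion-zero k n (x₀Form k (suc n) h) P
        (λ k′ k′≤k → rest-zero k′ (ℕP.m≤n⇒m≤1+n k′≤k)) (proj₂ ∘ coeffs-zero))

  -- Induct on m: for fixed values of
  -- the last m−1 grid coordinates h is a polynomial of degree ≤ k in x₀ with
  -- the N > k roots A₁, so all its coefficients vanish, and these are forms on
  -- a smaller grid.
  form-vanishing-on-grid : ∀ {N} m (A : Fin m → Fin N → Carrier) → (∀ i → InjectiveFamily (A i)) →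
    ∀ k (h : Form k (suc m)) → k < N → (∀ f → evalForm k (suc m) h (gridPoint A f) ≈ 0#) → h ≈ᵥ 0ᵥ
  form-vanishing-on-grid zero    A A-inj k h k<N vanish = unary-form-zero k h (vanish (λ ()))
  form-vanishing-on-grid (suc m) A A-inj k h k<N vanish =
    x₀Expansion-zero k m h (gridPoint (tail A))
      (λ k′ k′≤k h′ → form-vanishing-on-grid m (tail A) (A-inj ∘ suc) k′ h′ (ℕP.≤-<-trans k′≤k k<N))
      (λ g → roots⇒IsZero k (x₀Expansion k m h (gridPoint (tail A) g)) root
               (λ j j′ e → FinP.inject≤-injective k<N k<N j j′ (A-inj zero _ _ e)) (roots g))
    where
    root : Fin (suc k) → Carrier
    root j = A zero (inject≤ j k<N)
    roots : ∀ g j → eval (x₀Expansion k m h (gridPoint (tail A) g)) (root j) ≈ 0#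
    roots g j = begin
      eval (x₀Expansion k m h (gridPoint (tail A) g)) (root j)
        ≈⟨ eval-x₀Expansion k m h _ (root j) ⟩
      evalForm k (suc (suc m)) h (root j ∷ᵥ gridPoint (tail A) g)
        ≈⟨ evalForm-cong k (suc (suc m)) h (λ { zero → refl ; (suc i) → refl }) ⟩
      evalForm k (suc (suc m)) h (gridPoint A (inject≤ j k<N ∷ᵥ g))
        ≈⟨ vanish (inject≤ j k<N ∷ᵥ g) ⟩
      0# ∎

  Linear : ∀ {k} → (Vect k → Carrier) → Set (c ⊔ ℓ)
  Linear {k} E = (∀ {x y} → x ≈ᵥ y → E x ≈ E y)
               × (∀ x y α β → E ((α · x) +ᵥ (β · y)) ≈ α * E x + β * E y)

  Separating : ∀ {k M} → (Fin M → Vect k → Carrier) → Set (c ⊔ ℓ)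
  Separating E = ∀ x → (∀ j → E j x ≈ 0#) → x ≈ᵥ 0ᵥ

  -- Double negation commutes with finite conjunctions.  (Equality in K need not
  -- be decidable, so the dimension bound is first obtained doubly negated.)
  ¬¬-all : ∀ M {P : Fin M → Set ℓ} → (∀ j → ¬ ¬ P j) → ¬ ¬ (∀ j → P j)
  ¬¬-all zero    ¬¬P ¬all = ¬all (λ ())
  ¬¬-all (suc M) ¬¬P ¬all = ¬¬P zero (λ P₀ → ¬¬-all M (¬¬P ∘ suc)
    (λ P-rest → ¬all (λ { zero → P₀ ; (suc j) → P-rest j })))

  e₀ : ∀ {k} → Vect (suc k)
  e₀ = 1# ∷ᵥ 0ᵥ

  -- Gaussian elimination of x₀ using a pivot E_j with α = E_j(e₀) ≠ 0: the
  -- kernel of E_j is parametrised by  y ↦ lift y = (−α⁻¹·E_j(0,y), y),  and the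
  -- other functionals composed with lift are linear and still separating.
  module Pivot {k M} (E : Fin (suc M) → Vect (suc k) → Carrier) (E-linear : ∀ j → Linear (E j))
               (j : Fin (suc M)) (pivot≉0 : ¬ (E j e₀ ≈ 0#)) where

    α β γ : Carrier
    α = E j e₀
    β = proj₁ (inverse α pivot≉0)
    γ = - β

    Ej-cong : ∀ {x y} → x ≈ᵥ y → E j x ≈ E j y
    Ej-cong = proj₁ (E-linear j)

    Ej-linear : ∀ x y a b → E j ((a · x) +ᵥ (b · y)) ≈ a * E j x + b * E j y
    Ej-linear = proj₂ (E-linear j)

    U : Vect k → Carrier
    U y = E j (0# ∷ᵥ y)

    U-linear : ∀ x y a b → U ((a · x) +ᵥ (b · y)) ≈ a * U x + b * U y
    U-linear x y a b = trans (Ej-cong (λ { zero → zero≈α0+β0 a b ; (suc i) → refl }))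
                             (Ej-linear (0# ∷ᵥ x) (0# ∷ᵥ y) a b)

    lift : Vect k → Vect (suc k)
    lift y = (γ * U y) ∷ᵥ y

    lift-cong : ∀ {x y} → x ≈ᵥ y → lift x ≈ᵥ lift y
    lift-cong x≈y zero    = *-cong refl (Ej-cong (λ { zero → refl ; (suc i) → x≈y i }))
    lift-cong x≈y (suc i) = x≈y i

    lift-linear : ∀ x y a b → lift ((a · x) +ᵥ (b · y)) ≈ᵥ ((a · lift x) +ᵥ (b · lift y))
    lift-linear x y a b zero = trans (*-cong refl (U-linear x y a b))
      (solve 5 (λ γ a b X Y → γ :* (a :* X :+ b :* Y) := a :* (γ :* X) :+ b :* (γ :* Y))
               refl γ a b (U x) (U y))
    lift-linear x y a b (suc i) = refl

    γα≈-1 : γ * α ≈ - 1#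
    γα≈-1 = trans (sym (R.-‿distribˡ-* β α)) (-‿cong (trans (*-comm β α) (proj₂ (inverse α pivot≉0))))

    E-lift≈0 : ∀ y → E j (lift y) ≈ 0#
    E-lift≈0 y = begin
      E j (lift y)                                  ≈⟨ Ej-cong decompose ⟩
      E j (((γ * U y) · e₀) +ᵥ (1# · (0# ∷ᵥ y)))    ≈⟨ Ej-linear e₀ (0# ∷ᵥ y) _ _ ⟩
      (γ * U y) * α + 1# * U y                      ≈⟨ solve 3 (λ γ U α → (γ :* U) :* α :+ con 1 :* U
                                                                    := (γ :* α) :* U :+ U) refl γ (U y) α ⟩
      (γ * α) * U y + U y                           ≈⟨ +-cong (trans (*-cong γα≈-1 refl) (R.-1*x≈-x (U y))) refl ⟩
      - U y + U y                                   ≈⟨ -‿inverseˡ (U y) ⟩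
      0#                                            ∎
      where
      decompose : lift y ≈ᵥ (((γ * U y) · e₀) +ᵥ (1# · (0# ∷ᵥ y)))
      decompose zero    = sym (trans (+-cong (*-identityʳ _) (zeroʳ _)) (+-identityʳ _))
      decompose (suc i) = sym (trans (+-cong (zeroʳ _) (*-identityˡ _)) (+-identityˡ _))

    reduced : Fin M → Vect k → Carrier
    reduced i y = E (punchIn j i) (lift y)

    reduced-linear : ∀ i → Linear (reduced i)
    reduced-linear i =
      (λ x≈y → proj₁ (E-linear (punchIn j i)) (lift-cong x≈y)) ,
      (λ x y a b → trans (proj₁ (E-linear (punchIn j i)) (lift-linear x y a b))
                         (proj₂ (E-linear (punchIn j i)) (lift x) (lift y) a b))

    reduced-separating : Separating E → Separating reduced
    reduced-separating E-sep y reduced≈0 i = E-sep (lift y) all≈0 (suc i)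
      where
      all≈0 : ∀ j′ → E j′ (lift y) ≈ 0#
      all≈0 j′ with j′ FinP.≟ j
      ... | yes ≡.refl = E-lift≈0 y
      ... | no  j′≢j   = ≡.subst (λ w → E w (lift y) ≈ 0#)
                           (FinP.punchIn-punchOut (j′≢j ∘ ≡.sym)) (reduced≈0 _)

  e₀-not-common-zero : ∀ {k M} {E : Fin M → Vect (suc k) → Carrier} → Separating E → ¬ (∀ j → E j e₀ ≈ 0#)
  e₀-not-common-zero E-sep all≈0 = 0≉1 (sym (E-sep e₀ all≈0 zero))

  -- M separating linear functionals on K^k force k ≤ M (doubly negated): some
  -- functional is nonzero at e₀, and pivoting on it reduces both k and M.
  separating⇒dim≤ : ∀ k M (E : Fin M → Vect k → Carrier) → (∀ j → Linear (E j)) → Separating E → ¬ ¬ (k ≤ M)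
  separating⇒dim≤ zero    M       _ _        _     k≰M = k≰M z≤n
  separating⇒dim≤ (suc k) zero    _ _        E-sep _   = e₀-not-common-zero E-sep (λ ())
  separating⇒dim≤ (suc k) (suc M) E E-linear E-sep k≰M =
    ¬¬-all (suc M) no-pivot (e₀-not-common-zero E-sep)
    where
    no-pivot : ∀ j → ¬ ¬ (E j e₀ ≈ 0#)
    no-pivot j pivot≉0 =
      separating⇒dim≤ k M reduced reduced-linear (reduced-separating E-sep) (k≰M ∘ s≤s)
      where open Pivot E E-linear j pivot≉0

  sumᵥ-linear : ∀ {n} k (b : Fin k → Vect n) (c d : Vect k) α β →
    sumᵥ k (λ j → ((α · c) +ᵥ (β · d)) j · b j)
      ≈ᵥ ((α · sumᵥ k (λ j → c j · b j)) +ᵥ (β · sumᵥ k (λ j → d j · b j)))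
  sumᵥ-linear zero    b c d α β i = zero≈α0+β0 α β
  sumᵥ-linear (suc k) b c d α β i =
    trans (+-cong refl (sumᵥ-linear k (tail b) (tail c) (tail d) α β i))
          (solve 7 (λ α β c₀ d₀ b₀ C D → (α :* c₀ :+ β :* d₀) :* b₀ :+ (α :* C :+ β :* D)
                                        := α :* (c₀ :* b₀ :+ C) :+ β :* (d₀ :* b₀ :+ D))
                   refl α β (c zero) (d zero) (b zero i) _ _)

  withOne-combination : ∀ {n} m (b : Fin (suc m) → Vect n) (a : Vect m) →
    sumᵥ (suc m) (λ j → withOne m a j · b j) ≈ᵥ (sumᵥ m (λ i → a i · b (inject₁ i)) +ᵥ b (fromℕ m))
  withOne-combination zero    b a i = trans (+-identityʳ _) (trans (*-identityˡ _) (sym (+-identityˡ _)))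
  withOne-combination (suc m) b a i =
    trans (+-cong refl (withOne-combination m (tail b) (tail a) i)) (sym (+-assoc _ _ _))

  1x+[-1]y≈x-y : ∀ x y → 1# * x + (- 1#) * y ≈ x - y
  1x+[-1]y≈x-y x y = +-cong (*-identityˡ x) (R.-1*x≈-x y)

  module Coordinates {n} (b : Fin n → Vect n) (basis : IsBasis b) where

    coord : Vect n → Vect n
    coord x = proj₁ (proj₂ basis x)

    coord-spec : ∀ x → sumᵥ n (λ j → coord x j · b j) ≈ᵥ x
    coord-spec x = proj₂ (proj₂ basis x)

    coord-unique : ∀ (d : Vect n) x → sumᵥ n (λ j → d j · b j) ≈ᵥ x → d ≈ᵥ coord x
    coord-unique d x d-spec j =
      R.x∙y⁻¹≈ε⇒x≈y (d j) (coord x j)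
        (trans (sym (1x+[-1]y≈x-y (d j) (coord x j))) (proj₁ basis _ difference≈0 j))
      where
      difference≈0 : sumᵥ n (λ j → ((1# · d) +ᵥ ((- 1#) · coord x)) j · b j) ≈ᵥ 0ᵥ
      difference≈0 i = begin
        _                                 ≈⟨ sumᵥ-linear n b d (coord x) 1# (- 1#) i ⟩
        1# * _ + (- 1#) * _               ≈⟨ +-cong (*-cong refl (d-spec i)) (*-cong refl (coord-spec x i)) ⟩
        1# * x i + (- 1#) * x i           ≈⟨ 1x+[-1]y≈x-y (x i) (x i) ⟩
        x i - x i                         ≈⟨ -‿inverseʳ (x i) ⟩
        0#                                ∎

    coord-cong : ∀ {x y} → x ≈ᵥ y → coord x ≈ᵥ coord y
    coord-cong {x} {y} x≈y = coord-unique (coord x) y (λ i → trans (coord-spec x i) (x≈y i))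

    coord-line : ∀ u v t → coord (u +ᵥ (t · v)) ≈ᵥ (coord u +ᵥ (t · coord v))
    coord-line u v t j =
      trans (sym (coord-unique d _ d-spec j)) (+-cong (*-identityˡ _) refl)
      where
      d : Vect n
      d = (1# · coord u) +ᵥ (t · coord v)
      d-spec : sumᵥ n (λ j → d j · b j) ≈ᵥ (u +ᵥ (t · v))
      d-spec i = trans (sumᵥ-linear n b (coord u) (coord v) 1# t i)
                       (+-cong (trans (*-cong refl (coord-spec u i)) (*-identityˡ _)) (*-cong refl (coord-spec v i)))

    coord-scale : ∀ (d : Vect n) w x μ → sumᵥ n (λ j → d j · b j) ≈ᵥ w → x ≈ᵥ (μ · w) → coord x ≈ᵥ (μ · d)
    coord-scale d w x μ d-spec x≈μw j =
      trans (sym (coord-unique μd₊ x μd₊-spec j)) (trans (+-cong refl (zeroˡ _)) (+-identityʳ _))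
      where
      μd₊ : Vect n
      μd₊ = (μ · d) +ᵥ (0# · d)
      μd₊-spec : sumᵥ n (λ j → μd₊ j · b j) ≈ᵥ x
      μd₊-spec i = trans (sumᵥ-linear n b d d μ 0# i)
        (trans (+-cong (*-cong refl (d-spec i)) (zeroˡ _)) (trans (+-identityʳ _) (sym (x≈μw i))))

  lookup-injective : ∀ {n} {xs : List (Vect n)} → AllPairs (λ p q → ¬ (p ≈ᵥ q)) xs →
    ∀ i j → lookup xs i ≈ᵥ lookup xs j → i ≡ j
  lookup-injective (_     ∷ _)        zero    zero    _ = ≡.refl
  lookup-injective (x≉xs ∷ _)        zero    (suc j) e = ⊥-elim (All.lookup x≉xs (∈-lookup j) e)
  lookup-injective (x≉xs ∷ _)        (suc i) zero    e = ⊥-elim (All.lookup x≉xs (∈-lookup i) (sym ∘ e))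
  lookup-injective (_     ∷ distinct) (suc i) (suc j) e = ≡.cong suc (lookup-injective distinct i j e)

  module LowerBound
    (m N : ℕ) (Line : Set c) (base dir : Line → Vect (suc m))
    (dir≉0 : ∀ l → ¬ (dir l ≈ᵥ 0ᵥ))
    (b : Fin (suc m) → Vect (suc m)) (basis : IsBasis b)
    (A : Fin m → Fin N → Carrier) (A-inj : ∀ i → InjectiveFamily (A i))
    (grid : ∀ (f : Fin m → Fin N) → ∃ λ l →
              SameDirection (dir l) (sumᵥ m (λ i → A i (f i) · b (inject₁ i)) +ᵥ b (fromℕ m)))
    (S : List (Vect (suc m))) (S-distinct : AllPairs (λ p q → ¬ (p ≈ᵥ q)) S)
    (lines : ∀ l → ∃ λ (g : Fin N → Fin (length S))
               → (∀ i j → g i ≡ g j → i ≡ j) × (∀ i → OnLine (lookup S (g i)) (base l) (dir l)))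
    where

    open Coordinates b basis

    n : ℕ
    n = suc m

    point : Fin (length S) → Vect n
    point j = coord (lookup S j)

    VanishesOnS : ∀ D → Poly D n → Set ℓ
    VanishesOnS D F = ∀ j → evalPoly D n F (point j) ≈ 0#

    module PointsOn (l : Line) where
      index : Fin N → Fin (length S)
      index = proj₁ (lines l)

      param : Fin N → Carrier
      param i = proj₁ (proj₂ (proj₂ (lines l)) i)

      param-spec : ∀ i → lookup S (index i) ≈ᵥ (base l +ᵥ (param i · dir l))
      param-spec i = proj₂ (proj₂ (proj₂ (lines l)) i)

      param-injective : InjectiveFamily param
      param-injective i i′ e = proj₁ (proj₂ (lines l)) i i′ (lookup-injective S-distinct _ _
        (λ k → trans (param-spec i k) (trans (+-cong refl (*-cong e refl)) (sym (param-spec i′ k)))))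

      point-param : ∀ i → point (index i) ≈ᵥ (coord (base l) +ᵥ (param i · coord (dir l)))
      point-param i k = trans (coord-cong (param-spec i) k) (coord-line (base l) (dir l) (param i) k)

    topForm-vanishes-on-directions : ∀ D → D < N → (F : Poly (suc D) n) → VanishesOnS (suc D) F →
      ∀ l → evalForm D n (topForm D n F) (coord (dir l)) ≈ 0#
    topForm-vanishes-on-directions D D<N F F-van l =
      topForm-vanishes D n F (coord (base l)) (coord (dir l)) (param ∘ λ j → inject≤ j D<N)
        (λ j j′ e → FinP.inject≤-injective D<N D<N j j′ (param-injective _ _ e))
        (λ j → trans (evalPoly-cong (suc D) n F (λ k → sym (point-param _ k))) (F-van _))
      where open PointsOn l

    -- Every grid point is a nonzero multiple of the coordinates of a line
    -- direction, so by homogeneity the top form vanishes on the grid.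
    topForm-vanishes-on-grid : ∀ D → D < N → (F : Poly (suc D) n) → VanishesOnS (suc D) F →
      ∀ f → evalForm D n (topForm D n F) (gridPoint A f) ≈ 0#
    topForm-vanishes-on-grid D D<N F F-van f =
      ^-cancel-nonzero μ D μ≉0 (begin
        μ ^ D * evalForm D n h (gridPoint A f)  ≈⟨ sym (evalForm-homogeneous D n h μ _) ⟩
        evalForm D n h (μ · gridPoint A f)      ≈⟨ evalForm-cong D n h (λ k → sym (coord-dir k)) ⟩
        evalForm D n h (coord (dir l))          ≈⟨ topForm-vanishes-on-directions D D<N F F-van l ⟩
        0#                                      ∎)
      where
      h : Form D n
      h = topForm D n F
      l : Line
      l = proj₁ (grid f)
      μ : Carrier
      μ = proj₁ (proj₂ (grid f))
      dir≈μw : dir l ≈ᵥ (μ · (sumᵥ m (λ i → A i (f i) · b (inject₁ i)) +ᵥ b (fromℕ m)))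
      dir≈μw = proj₂ (proj₂ (grid f))
      μ≉0 : ¬ (μ ≈ 0#)
      μ≉0 μ≈0 = dir≉0 l (λ k → trans (dir≈μw k) (trans (*-cong μ≈0 refl) (zeroˡ _)))
      coord-dir : coord (dir l) ≈ᵥ (μ · gridPoint A f)
      coord-dir = coord-scale (gridPoint A f) _ (dir l) μ
                    (withOne-combination m b (λ i → A i (f i))) dir≈μw

    -- A polynomial of degree < D ≤ N vanishing on S is zero: its top form is
    -- zero by the grid lemma, and induction applies to the rest.
    vanishing⇒zero : ∀ D → D ≤ N → (F : Poly D n) → VanishesOnS D F → F ≈ᵥ 0ᵥ
    vanishing⇒zero zero    _   F F-van ()
    vanishing⇒zero (suc D) D<N F F-van =
      zero-split (polyDim D n) (homDim D n) F
        (vanishing⇒zero D (ℕP.<⇒≤ D<N) (lowerPart D n F) lower-van) top≈0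
      where
      top≈0 : topForm D n F ≈ᵥ 0ᵥ
      top≈0 = form-vanishing-on-grid m A A-inj D (topForm D n F) D<N
                (topForm-vanishes-on-grid D D<N F F-van)
      lower-van : VanishesOnS D (lowerPart D n F)
      lower-van j = begin
        evalPoly D n (lowerPart D n F) (point j)        ≈⟨ sym (+-identityʳ _) ⟩
        evalPoly D n (lowerPart D n F) (point j) + 0#   ≈⟨ +-cong refl (sym (evalForm-zero D n _ top≈0 (point j))) ⟩
        evalPoly (suc D) n F (point j)                  ≈⟨ F-van j ⟩
        0#                                              ∎

    -- Evaluation at the points of S: |S| separating linear functionals on the
    -- space of polynomials of degree < N, whose dimension is C(N+m, m+1).
    lowerBound : (N ℕ.+ m) C suc m ≤ length S
    lowerBound =
      ≡.subst (_≤ length S) (polyDim-binomial N m)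
        (decidable-stable (polyDim N n ℕ.≤? length S)
          (separating⇒dim≤ (polyDim N n) (length S) evaluation evaluation-linear
            (λ F → vanishing⇒zero N ℕP.≤-refl F)))
      where
      evaluation : Fin (length S) → Poly N n → Carrier
      evaluation j F = evalPoly N n F (point j)
      evaluation-linear : ∀ j → Linear (evaluation j)
      evaluation-linear j = (λ F≈F′ → evalPoly-congᶜ N n F≈F′ (point j))
                          , (λ F F′ α β → evalPoly-linear N n F F′ α β (point j))

open import Data.Nat using (_+_) renaming (suc to sucℕ)

theorem3p3 : ∀ {c ℓ} (K : Field c ℓ) → let open Field K using (Carrier) in let open AffineSpace K in
    (m : ℕ) → 1 ≤ m → (N : ℕ)
    → (Line : Set c) (base dir : Line → Vect (sucℕ m))
    → (∀ l → ¬ (dir l ≈ᵥ 0ᵥ))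
    → (∃ λ (b : Fin (sucℕ m) → Vect (sucℕ m)) → IsBasis b
         × ∃ λ (A : Fin m → Fin N → Carrier) → (∀ i → InjectiveFamily (A i))
         × (∀ (f : Fin m → Fin N) → ∃ λ l →
              SameDirection (dir l)
                (sumᵥ m (λ i → A i (f i) · b (inject₁ i)) +ᵥ b (fromℕ m))))
    → (S : List (Vect (sucℕ m)))
    → AllPairs (λ p q → ¬ (p ≈ᵥ q)) S
    → (∀ l → ∃ λ (g : Fin N → Fin (length S))
         → (∀ i j → g i ≡ g j → i ≡ j)
         × (∀ i → OnLine (lookup S (g i)) (base l) (dir l)))
    → ((N + m) C (sucℕ m)) ≤ length S
theorem3p3 K m _ N Line base dir dir≉0 (b , basis , A , A-inj , grid) S S-distinct lines =
  LowerBound.lowerBound m N Line base dir dir≉0 b basis A A-inj grid S S-distinct lines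
  where open PolynomialMethod K
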